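{- For every integer $m\ge 3$ with $m\neq 4$, $\chi_d^{\min}(P_m)\le \chi_d^{\min}(C_m)$, where $P_m$ and $C_m$ denote the path graph and the cycle graph on $m$ vertices.
   Context: All digraphs are orientations of simple graphs. For a digraph $D$ and $v\in V(D)$, $N^+(v)=\{u: vu\in A(D)\}$. A dominator coloring of $D$ is a partition of $V(D)$ into color classes such that (i) it is a proper coloring of the underlying graph (adjacent vertices receive different colors), and (ii) every vertex $v$ with at least one out-neighbor dominates some color class, i.e., there is a color class $C$ with $C\subseteq N^+(v)$; vertices of out-degree $0$ are not required to dominate anything. $\chi_d(D)$ is the minimum number of color classes in a dominator coloring of $D$. For a graph $G$, $\chi_d^{\min}(G)$ is the minimum of $\chi_d(D)$ over all orientations $D$ of $G$. -}

module Defs where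

open import Data.Nat using (ℕ; zero; suc; _≤_; _∸_)
open import Data.Fin using (Fin; toℕ)
open import Data.Product using (Σ; ∃; _×_)
open import Data.Sum using (_⊎_)
open import Relation.Binary.PropositionalEquality using (_≡_; _≢_)
open import Relation.Nullary using (¬_)

Graph : ℕ → Set₁
Graph n = Fin n → Fin n → Set

PathG : (n : ℕ) → Graph n
PathG n u v = (toℕ v ≡ suc (toℕ u)) ⊎ (toℕ u ≡ suc (toℕ v))

CycleG : (n : ℕ) → Graph n
CycleG n u v = PathG n u v
             ⊎ ((toℕ u ≡ 0 × toℕ v ≡ n ∸ 1) ⊎ (toℕ v ≡ 0 × toℕ u ≡ n ∸ 1))

record IsOrientation {n : ℕ} (G : Graph n) (D : Fin n → Fin n → Set) : Set where
  field
    arc⇒edge : ∀ u v → D u v → G u v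
    edge⇒arc : ∀ u v → G u v → D u v ⊎ D v u
    antisym  : ∀ u v → D u v → ¬ D v u

-- A dominator coloring of the orientation D of G using (at most) k colors:
-- c assigns colors; color classes are c⁻¹(i) (empty ones are simply unused).
record IsDominatorColoring {n : ℕ} (G : Graph n) (D : Fin n → Fin n → Set)
                           (k : ℕ) (c : Fin n → Fin k) : Set where
  field
    proper    : ∀ u v → G u v → c u ≢ c v
    dominates : ∀ v → (∃ λ w → D v w) →
                Σ (Fin k) λ i → (∃ λ u → c u ≡ i) × (∀ u → c u ≡ i → D v u)

HasDomColoring : {n : ℕ} → Graph n → (Fin n → Fin n → Set) → ℕ → Set
HasDomColoring {n} G D k = Σ (Fin n → Fin k) λ c → IsDominatorColoring G D k c

IsChiDMin : {n : ℕ} → Graph n → ℕ → Set₁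
IsChiDMin {n} G k =
  (Σ (Fin n → Fin n → Set) λ D → IsOrientation G D × HasDomColoring G D k)
  × (∀ (D : Fin n → Fin n → Set) (k' : ℕ) →
       IsOrientation G D → HasDomColoring G D k' → k ≤ k')

-- Let D be an orientation of C_m with a dominator colouring c.  Deleting an edge {x, x + 1}
-- leaves a path on which c is still proper, and still dominating provided the tail of the
-- arc on that edge either loses its only out-neighbour or already dominates a class avoiding
-- the head.  If no edge of the cycle can be deleted this way, no two consecutive arcs point
-- the same way; so for an arc u → u + 1 the vertex u + 2 points at both u + 1 and u + 3,
-- which then share a colour class dominated by u.  Thus u is adjacent to u + 3, forcing
-- m ∣ 2 or m ∣ 4.
module Submission where

open import Defs
open import Data.Nat using (ℕ; zero; suc; _+_; _*_; _∸_; _≤_; s≤s; z≤n; s≤s⁻¹; _≤?_; _%_)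
open import Data.Nat.Properties
  using (+-assoc; +-comm; +-suc; +-identityʳ; +-cancelʳ-≡; m∸n+n≡m; m+[n∸m]≡n; m≤n⇒m<n∨m≡n)
open import Data.Nat.DivMod
  using (_mod_; _/_; m≡m%n+[m/n]*n; %-distribˡ-+; m%n%n≡m%n; m<n⇒m%n≡m; %-remove-+ˡ; %-remove-+ʳ; n%n≡0)
open import Data.Nat.Divisibility using (_∣_; divides; ∣-refl; >⇒∤)
open import Data.Fin using (Fin; zero; toℕ; fromℕ; _≟_)
open import Data.Fin.Properties using (toℕ-injective; toℕ<n; toℕ-fromℕ; toℕ-fromℕ<)
open import Data.Product using (Σ; ∃; _×_; _,_; proj₁; proj₂)
open import Data.Sum using (_⊎_; inj₁; inj₂) renaming (swap to ⊎-swap; map to ⊎-map)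
open import Data.Empty using (⊥-elim)
open import Function using (_∘_; _⇔_; mk⇔; Equivalence)
open import Relation.Nullary using (¬_; yes; no)
open import Relation.Binary.PropositionalEquality

open import Function.Properties.Equivalence using () renaming (trans to ⇔-trans)

open Equivalence using (to; from)

DominatesClass : ∀ {n k} → (Fin n → Fin n → Set) → (Fin n → Fin k) → Fin n → Fin k → Set
DominatesClass D c v i = (∃ λ u → c u ≡ i) × (∀ u → c u ≡ i → D v u)

Dominates : ∀ {n k} → (Fin n → Fin n → Set) → (Fin n → Fin k) → Fin n → Set
Dominates {k = k} D c v = Σ (Fin k) (DominatesClass D c v)

ArcRemovable : ∀ {n k} → (Fin n → Fin n → Set) → (Fin n → Fin k) → Fin n → Fin n → Set
ArcRemovable D c s t =
  (∀ y → D s y → y ≡ t) ⊎ (Σ _ λ i → DominatesClass D c s i × c t ≢ i)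

EdgeRemovable : ∀ {n k} → (Fin n → Fin n → Set) → (Fin n → Fin k) → Fin n → Fin n → Set
EdgeRemovable D c s t = (D s t → ArcRemovable D c s t) × (D t s → ArcRemovable D c t s)

removeEdge : ∀ {n} → Graph n → Fin n → Fin n → Graph n
removeEdge G s t u w = G u w × ¬ (u ≡ s × w ≡ t) × ¬ (u ≡ t × w ≡ s)

removeEdge-sym : ∀ {n} {G : Graph n} {s t u w} → removeEdge G s t u w → removeEdge G t s u w
removeEdge-sym (e , ¬st , ¬ts) = e , ¬ts , ¬st

removeEdge-image : ∀ {n n'} {G : Graph n} {H : Graph n'} (φ : Fin n → Fin n') →
                   (∀ {u w} → φ u ≡ φ w → u ≡ w) → (∀ u w → G u w ⇔ H (φ u) (φ w)) →
                   ∀ s t u w → removeEdge G s t u w ⇔ removeEdge H (φ s) (φ t) (φ u) (φ w)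
removeEdge-image φ φ-injective φ-edge s t u w = mk⇔
  (λ (e , ¬st , ¬ts) → to (φ-edge u w) e , ¬st ∘ reflect , ¬ts ∘ reflect)
  (λ (e , ¬st , ¬ts) → from (φ-edge u w) e , ¬st ∘ preserve , ¬ts ∘ preserve)
  where
    reflect : ∀ {a b c d} → φ a ≡ φ b × φ c ≡ φ d → a ≡ b × c ≡ d
    reflect (e , e') = φ-injective e , φ-injective e'
    preserve : ∀ {a b c d} → a ≡ b × c ≡ d → φ a ≡ φ b × φ c ≡ φ d
    preserve (e , e') = cong φ e , cong φ e'

dominates-mono : ∀ {n k} {R R' : Fin n → Fin n → Set} {c : Fin n → Fin k} {v} →
                 (∀ u → R v u → R' v u) → Dominates R c v → Dominates R' c v
dominates-mono R⊆R' (i , nonempty , sub) = i , nonempty , λ u cu → R⊆R' u (sub u cu)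

module _ {n} {G D : Graph n} (O : IsOrientation G D) where
  open IsOrientation O

  removeEdge-orientation : ∀ s t → IsOrientation (removeEdge G s t) (removeEdge D s t)
  removeEdge-orientation s t = record
    { arc⇒edge = λ u w (d , ¬st , ¬ts) → arc⇒edge u w d , ¬st , ¬ts
    ; edge⇒arc = λ u w (e , ¬st , ¬ts) → ⊎-map (_, ¬st , ¬ts)
                   (_, (λ (w≡s , u≡t) → ¬ts (u≡t , w≡s)) , (λ (w≡t , u≡s) → ¬st (u≡s , w≡t)))
                   (edge⇒arc u w e)
    ; antisym = λ u w d d' → antisym u w (proj₁ d) (proj₁ d')
    }

  module _ {k} {c : Fin n → Fin k} (dc : IsDominatorColoring G D k c) where
    open IsDominatorColoring dc

    private
      ¬loop : ∀ {s t u} → D s u → ¬ (s ≡ t × u ≡ s)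
      ¬loop d (_ , refl) = antisym _ _ d d

    dominates-at-endpoint : ∀ s t → D s t ⊎ D t s → (D s t → ArcRemovable D c s t) →
                            (∃ λ w → removeEdge D s t s w) → Dominates (removeEdge D s t) c s
    dominates-at-endpoint s t joined removable (w , d , ¬st , _) with joined
    ... | inj₁ s→t with removable s→t
    ...   | inj₁ onlyOut = ⊥-elim (¬st (refl , onlyOut w d))
    ...   | inj₂ (i , (nonempty , sub) , ct≢i) =
            i , nonempty , λ u cu → sub u cu , (λ (_ , u≡t) → ct≢i (subst (λ x → c x ≡ i) u≡t cu))
                                             , ¬loop (sub u cu)
    dominates-at-endpoint s t joined removable (w , d , _) | inj₂ t→s =
      dominates-mono {R = D} {R' = removeEdge D s t}
        (λ u s→u → s→u , (λ (_ , u≡t) → antisym t s t→s (subst (D s) u≡t s→u)) , ¬loop s→u)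
        (dominates s (w , d))

    removeEdge-domColoring : ∀ s t → D s t ⊎ D t s → EdgeRemovable D c s t →
                             IsDominatorColoring (removeEdge G s t) (removeEdge D s t) k c
    removeEdge-domColoring s t joined (removable-st , removable-ts) = record
      { proper = λ u w e → proper u w (proj₁ e)
      ; dominates = dom
      }
      where
        dom : ∀ v → (∃ λ w → removeEdge D s t v w) → Dominates (removeEdge D s t) c v
        dom v out with v ≟ s | v ≟ t
        ... | yes refl | _ = dominates-at-endpoint s t joined removable-st out
        ... | no _ | yes refl =
          dominates-mono {R = removeEdge D t s} {R' = removeEdge D s t} (λ _ → removeEdge-sym {G = D})
            (dominates-at-endpoint t s (⊎-swap joined) removable-ts
              (proj₁ out , removeEdge-sym {G = D} (proj₂ out)))
        ... | no v≢s | no v≢t =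
          dominates-mono {R = D} {R' = removeEdge D s t} (λ u d → d , v≢s ∘ proj₁ , v≢t ∘ proj₁)
            (dominates v (proj₁ out , proj₁ (proj₂ out)))

module _ {n n'} {G : Graph n} {H : Graph n'} (φ : Fin n → Fin n')
         (φ-edge : ∀ u w → G u w ⇔ H (φ u) (φ w)) where

  pullback-orientation : ∀ {D} → IsOrientation H D → IsOrientation G (λ u w → D (φ u) (φ w))
  pullback-orientation O = record
    { arc⇒edge = λ u w d → from (φ-edge u w) (arc⇒edge (φ u) (φ w) d)
    ; edge⇒arc = λ u w e → edge⇒arc (φ u) (φ w) (to (φ-edge u w) e)
    ; antisym = λ u w → antisym (φ u) (φ w)
    }
    where open IsOrientation O

  pullback-domColoring : (∀ v → ∃ λ u → φ u ≡ v) → ∀ {D k c} → IsDominatorColoring H D k c →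
                         IsDominatorColoring G (λ u w → D (φ u) (φ w)) k (c ∘ φ)
  pullback-domColoring φ-surjective {D} {c = c} dc = record
    { proper = λ u w e → proper (φ u) (φ w) (to (φ-edge u w) e)
    ; dominates = λ u (w , d) → pull (dominates (φ u) (φ w , d))
    }
    where
      open IsDominatorColoring dc
      pull : ∀ {u} → Dominates D c (φ u) → Dominates (λ u w → D (φ u) (φ w)) (c ∘ φ) u
      pull (i , (v , cv) , sub) =
        let (u , φu≡v) = φ-surjective v in
        i , (u , trans (cong c φu≡v) cv) , λ w cw → sub (φ w) cw

module CycleOrientation
  {n} {G : Graph n} (nxt : Fin n → Fin n)
  (nxt-injective : ∀ {x y} → nxt x ≡ nxt y → x ≡ y)
  (adjacent⇒nxt : ∀ {x y} → G x y → y ≡ nxt x ⊎ x ≡ nxt y)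
  (nxt-adjacent : ∀ x → G x (nxt x))
  (¬adjacent-nxt³ : ∀ x → ¬ G x (nxt (nxt (nxt x))))
  {D} (O : IsOrientation G D) {k} {c : Fin n → Fin k} (dc : IsDominatorColoring G D k c)
  where

  open IsOrientation O
  open IsDominatorColoring dc

  direction : ∀ x → D x (nxt x) ⊎ D (nxt x) x
  direction x = edge⇒arc x (nxt x) (nxt-adjacent x)

  module _ (noneRemovable : ∀ x → ¬ EdgeRemovable D c x (nxt x)) where

    arc-not-removable : ∀ {u v} → D u v → ¬ ArcRemovable D c u v
    arc-not-removable {u} {v} d removable with adjacent⇒nxt (arc⇒edge u v d)
    ... | inj₁ refl = noneRemovable u ((λ _ → removable) , λ d' → ⊥-elim (antisym u v d d'))
    ... | inj₂ refl = noneRemovable v ((λ d' → ⊥-elim (antisym u v d d')) , λ _ → removable)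

    dominated-colour : ∀ {u v} → D u v → ∀ i → DominatesClass D c u i → c v ≡ i
    dominated-colour {v = v} d i dom with c v ≟ i
    ... | yes cv≡i = cv≡i
    ... | no cv≢i = ⊥-elim (arc-not-removable d (inj₂ (i , dom , cv≢i)))

    out-neighbours-sameColour : ∀ {u v v'} → D u v → D u v' → c v ≡ c v'
    out-neighbours-sameColour {u} {v} d d' =
      let (i , dom) = dominates u (v , d) in
      trans (dominated-colour d i dom) (sym (dominated-colour d' i dom))

    dominates-colourClass : ∀ {u v} → D u v → ∀ w → c w ≡ c v → D u w
    dominates-colourClass {u} {v} d w cw≡cv =
      let (i , dom) = dominates u (v , d) in
      proj₂ dom w (trans cw≡cv (dominated-colour d i dom))

    ¬forward-forward : ∀ {u} → D u (nxt u) → ¬ D (nxt u) (nxt (nxt u))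
    ¬forward-forward {u} d₁ d₂ = arc-not-removable d₂ (inj₁ onlyOut)
      where
        onlyOut : ∀ y → D (nxt u) y → y ≡ nxt (nxt u)
        onlyOut y d with adjacent⇒nxt (arc⇒edge _ _ d)
        ... | inj₁ y≡nxt² = y≡nxt²
        ... | inj₂ e = ⊥-elim (antisym _ _ d₁ (subst (D (nxt u)) (sym (nxt-injective e)) d))

    ¬backward-backward : ∀ {u} → D (nxt (nxt u)) (nxt u) → ¬ D (nxt u) u
    ¬backward-backward {u} d₁ d₂ = arc-not-removable d₂ (inj₁ onlyOut)
      where
        onlyOut : ∀ y → D (nxt u) y → y ≡ u
        onlyOut y d with adjacent⇒nxt (arc⇒edge _ _ d)
        ... | inj₁ refl = ⊥-elim (antisym _ _ d d₁)
        ... | inj₂ e = sym (nxt-injective e)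

    forward⇒backward : ∀ {u} → D u (nxt u) → D (nxt (nxt u)) (nxt u)
    forward⇒backward {u} d with direction (nxt u)
    ... | inj₁ d' = ⊥-elim (¬forward-forward d d')
    ... | inj₂ d' = d'

    backward⇒forward : ∀ {u} → D (nxt u) u → D (nxt u) (nxt (nxt u))
    backward⇒forward {u} d with direction (nxt u)
    ... | inj₁ d' = d'
    ... | inj₂ d' = ⊥-elim (¬backward-backward d' d)

    ¬forward : ∀ u → ¬ D u (nxt u)
    ¬forward u d = ¬adjacent-nxt³ u (arc⇒edge _ _ (dominates-colourClass d _ sameColour))
      where
        back = forward⇒backward d
        sameColour : c (nxt (nxt (nxt u))) ≡ c (nxt u)
        sameColour = out-neighbours-sameColour (backward⇒forward back) back

  some-edge-removable : Fin n → ¬ (∀ x → ¬ EdgeRemovable D c x (nxt x))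
  some-edge-removable x noneRemovable with direction x
  ... | inj₁ d = ¬forward noneRemovable x d
  ... | inj₂ d = ¬forward noneRemovable (nxt x) (backward⇒forward noneRemovable d)

module Rotation (n : ℕ) where

  private
    m : ℕ
    m = suc n

  rot : ℕ → Fin m → Fin m
  rot r i = (r + toℕ i) mod m

  nxt : Fin m → Fin m
  nxt = rot 1

  toℕ-rot : ∀ r i → toℕ (rot r i) ≡ (r + toℕ i) % m
  toℕ-rot r i = toℕ-fromℕ< _

  rot-rot : ∀ r q i → rot r (rot q i) ≡ rot (r + q) i
  rot-rot r q i = toℕ-injective (begin
    toℕ (rot r (rot q i))      ≡⟨ toℕ-rot r (rot q i) ⟩
    (r + toℕ (rot q i)) % m    ≡⟨ cong (λ a → (r + a) % m) (toℕ-rot q i) ⟩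
    (r + (q + a) % m) % m      ≡⟨ %-distribˡ-+ r ((q + a) % m) m ⟩
    (r % m + (q + a) % m % m) % m ≡⟨ cong (λ b → (r % m + b) % m) (m%n%n≡m%n (q + a) m) ⟩
    (r % m + (q + a) % m) % m  ≡⟨ %-distribˡ-+ r (q + a) m ⟨
    (r + (q + a)) % m          ≡⟨ cong (_% m) (+-assoc r q a) ⟨
    (r + q + a) % m            ≡⟨ toℕ-rot (r + q) i ⟨
    toℕ (rot (r + q) i)        ∎)
    where
      open ≡-Reasoning
      a = toℕ i

  rot-full : ∀ i → rot m i ≡ i
  rot-full i = toℕ-injective (begin
    toℕ (rot m i)    ≡⟨ toℕ-rot m i ⟩
    (m + toℕ i) % m  ≡⟨ %-remove-+ˡ (toℕ i) ∣-refl ⟩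
    toℕ i % m        ≡⟨ m<n⇒m%n≡m (toℕ<n i) ⟩
    toℕ i            ∎)
    where open ≡-Reasoning

  rot-inverseˡ : ∀ {r} → r ≤ m → ∀ i → rot (m ∸ r) (rot r i) ≡ i
  rot-inverseˡ {r} r≤m i =
    trans (rot-rot (m ∸ r) r i) (trans (cong (λ q → rot q i) (m∸n+n≡m r≤m)) (rot-full i))

  rot-inverseʳ : ∀ {r} → r ≤ m → ∀ i → rot r (rot (m ∸ r) i) ≡ i
  rot-inverseʳ {r} r≤m i =
    trans (rot-rot r (m ∸ r) i) (trans (cong (λ q → rot q i) (m+[n∸m]≡n r≤m)) (rot-full i))

  rot-injective : ∀ {r} → r ≤ m → ∀ {i j} → rot r i ≡ rot r j → i ≡ j
  rot-injective {r} r≤m {i} {j} e =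
    trans (sym (rot-inverseˡ r≤m i)) (trans (cong (rot (m ∸ r)) e) (rot-inverseˡ r≤m j))

  rot-surjective : ∀ {r} → r ≤ m → ∀ j → ∃ λ i → rot r i ≡ j
  rot-surjective r≤m j = _ , rot-inverseʳ r≤m j

  rot-fixed⇒∣ : ∀ {k i} → rot k i ≡ i → m ∣ k
  rot-fixed⇒∣ {k} {i} fixed = divides ((k + a) / m) (+-cancelʳ-≡ a k _ (begin
    k + a                        ≡⟨ m≡m%n+[m/n]*n (k + a) m ⟩
    (k + a) % m + (k + a) / m * m ≡⟨ cong (_+ (k + a) / m * m) [k+a]%m≡a ⟩
    a + (k + a) / m * m          ≡⟨ +-comm a _ ⟩
    (k + a) / m * m + a          ∎))
    where
      open ≡-Reasoning
      a = toℕ i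
      [k+a]%m≡a : (k + a) % m ≡ a
      [k+a]%m≡a = trans (sym (toℕ-rot k i)) (cong toℕ fixed)

  nxt-injective : ∀ {i j} → nxt i ≡ nxt j → i ≡ j
  nxt-injective = rot-injective (s≤s z≤n)

  nxt-rot : ∀ r i → nxt (rot r i) ≡ rot r (nxt i)
  nxt-rot r i = trans (rot-rot 1 r i) (trans (cong (λ q → rot q i) (+-comm 1 r)) (sym (rot-rot r 1 i)))

  suc⇒nxt : ∀ {u w} → toℕ w ≡ suc (toℕ u) → w ≡ nxt u
  suc⇒nxt {u} {w} w≡1+u = toℕ-injective (begin
    toℕ w           ≡⟨ m<n⇒m%n≡m (toℕ<n w) ⟨
    toℕ w % m       ≡⟨ cong (_% m) w≡1+u ⟩
    suc (toℕ u) % m ≡⟨ toℕ-rot 1 u ⟨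
    toℕ (nxt u)     ∎)
    where open ≡-Reasoning

  last⇒nxt : ∀ {u w} → toℕ u ≡ n → toℕ w ≡ 0 → w ≡ nxt u
  last⇒nxt {u} {w} u≡n w≡0 = toℕ-injective (begin
    toℕ w           ≡⟨ w≡0 ⟩
    0               ≡⟨ n%n≡0 m ⟨
    suc n % m       ≡⟨ cong (λ a → suc a % m) u≡n ⟨
    suc (toℕ u) % m ≡⟨ toℕ-rot 1 u ⟨
    toℕ (nxt u)     ∎)
    where open ≡-Reasoning

  rot-suc : ∀ r i → rot (suc r) i ≡ nxt (rot r i)
  rot-suc r i = sym (rot-rot 1 r i)

  nxt-adjacent : ∀ u → CycleG m u (nxt u)
  nxt-adjacent u with m≤n⇒m<n∨m≡n (s≤s⁻¹ (toℕ<n u))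
  ... | inj₁ u<n = inj₁ (inj₁ (trans (toℕ-rot 1 u) (m<n⇒m%n≡m (s≤s u<n))))
  ... | inj₂ u≡n =
    inj₂ (inj₂ (trans (toℕ-rot 1 u) (trans (cong (λ a → suc a % m) u≡n) (n%n≡0 m)) , u≡n))

  cycle-sym : ∀ {u w} → CycleG m u w → CycleG m w u
  cycle-sym = ⊎-map ⊎-swap ⊎-swap

  nxt⇒cycle : ∀ {u w} → w ≡ nxt u ⊎ u ≡ nxt w → CycleG m u w
  nxt⇒cycle (inj₁ refl) = nxt-adjacent _
  nxt⇒cycle (inj₂ refl) = cycle-sym (nxt-adjacent _)

  cycle⇒nxt : ∀ {u w} → CycleG m u w → w ≡ nxt u ⊎ u ≡ nxt w
  cycle⇒nxt (inj₁ (inj₁ w≡1+u)) = inj₁ (suc⇒nxt w≡1+u)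
  cycle⇒nxt (inj₁ (inj₂ u≡1+w)) = inj₂ (suc⇒nxt u≡1+w)
  cycle⇒nxt (inj₂ (inj₁ (u≡0 , w≡n))) = inj₂ (last⇒nxt w≡n u≡0)
  cycle⇒nxt (inj₂ (inj₂ (w≡0 , u≡n))) = inj₁ (last⇒nxt u≡n w≡0)

  cycle-rot : ∀ {r} → r ≤ m → ∀ u w → CycleG m u w ⇔ CycleG m (rot r u) (rot r w)
  cycle-rot {r} r≤m u w =
    mk⇔ (nxt⇒cycle ∘ ⊎-map forth forth ∘ cycle⇒nxt)
        (nxt⇒cycle ∘ ⊎-map back back ∘ cycle⇒nxt)
    where
      forth : ∀ {i j} → j ≡ nxt i → rot r j ≡ nxt (rot r i)
      forth {i} e = trans (cong (rot r) e) (sym (nxt-rot r i))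
      back : ∀ {i j} → rot r j ≡ nxt (rot r i) → j ≡ nxt i
      back {i} e = rot-injective r≤m (trans e (nxt-rot r i))

  ¬path-last-zero : 2 ≤ n → ¬ PathG m (fromℕ n) zero
  ¬path-last-zero n≥2 (inj₂ n≡1) with subst (2 ≤_) (trans (sym (toℕ-fromℕ n)) n≡1) n≥2
  ... | s≤s ()

  path⇔removeEdge-cycle : 2 ≤ n → ∀ u w → PathG m u w ⇔ removeEdge (CycleG m) (fromℕ n) zero u w
  path⇔removeEdge-cycle n≥2 u w = mk⇔
    (λ p → inj₁ p , (λ { (refl , refl) → ¬path-last-zero n≥2 p })
                  , (λ { (refl , refl) → ¬path-last-zero n≥2 (⊎-swap p) }))
    edge
    where
      edge : removeEdge (CycleG m) (fromℕ n) zero u w → PathG m u w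
      edge (inj₁ p , _) = p
      edge (inj₂ (inj₁ (u≡0 , w≡n)) , _ , ¬zero-last) =
        ⊥-elim (¬zero-last (toℕ-injective u≡0 , toℕ-injective (trans w≡n (sym (toℕ-fromℕ n)))))
      edge (inj₂ (inj₂ (w≡0 , u≡n)) , ¬last-zero , _) =
        ⊥-elim (¬last-zero (toℕ-injective (trans u≡n (sym (toℕ-fromℕ n))) , toℕ-injective w≡0))

  rot-last : ∀ x → rot (suc (toℕ x)) (fromℕ n) ≡ x
  rot-last x = toℕ-injective (begin
    toℕ (rot (suc (toℕ x)) (fromℕ n)) ≡⟨ toℕ-rot (suc (toℕ x)) (fromℕ n) ⟩
    (suc (toℕ x) + toℕ (fromℕ n)) % m ≡⟨ cong (λ a → (suc (toℕ x) + a) % m) (toℕ-fromℕ n) ⟩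
    (suc (toℕ x) + n) % m            ≡⟨ cong (_% m) (+-suc (toℕ x) n) ⟨
    (toℕ x + m) % m                  ≡⟨ %-remove-+ʳ (toℕ x) ∣-refl ⟩
    toℕ x % m                        ≡⟨ m<n⇒m%n≡m (toℕ<n x) ⟩
    toℕ x                            ∎)
    where open ≡-Reasoning

  rot-zero : ∀ x → rot (suc (toℕ x)) zero ≡ nxt x
  rot-zero x = toℕ-injective (begin
    toℕ (rot (suc (toℕ x)) zero) ≡⟨ toℕ-rot (suc (toℕ x)) zero ⟩
    suc (toℕ x + 0) % m         ≡⟨ cong (λ a → suc a % m) (+-identityʳ (toℕ x)) ⟩
    suc (toℕ x) % m             ≡⟨ toℕ-rot 1 x ⟨
    toℕ (nxt x)                 ∎)
    where open ≡-Reasoning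

  path⇔removeEdge-at : 2 ≤ n → ∀ x u w →
    PathG m u w ⇔ removeEdge (CycleG m) x (nxt x) (rot (suc (toℕ x)) u) (rot (suc (toℕ x)) w)
  path⇔removeEdge-at n≥2 x u w =
    subst₂ (λ s t → PathG m u w ⇔ removeEdge (CycleG m) s t (σ u) (σ w)) (rot-last x) (rot-zero x)
      (⇔-trans (path⇔removeEdge-cycle n≥2 u w)
               (removeEdge-image {G = CycleG m} {H = CycleG m} σ (rot-injective (toℕ<n x))
                                 (cycle-rot (toℕ<n x)) (fromℕ n) zero u w))
    where σ = rot (suc (toℕ x))

  removableEdge⇒path-domColoring : 2 ≤ n → ∀ {D k c} →
    IsOrientation (CycleG m) D → IsDominatorColoring (CycleG m) D k c →
    ∀ x → EdgeRemovable D c x (nxt x) →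
    Σ _ λ D' → IsOrientation (PathG m) D' × HasDomColoring (PathG m) D' k
  removableEdge⇒path-domColoring n≥2 {D} {c = c} O dc x removable =
    (λ u w → removeEdge D x (nxt x) (σ u) (σ w)) ,
    pullback-orientation σ iso (removeEdge-orientation O x (nxt x)) ,
    c ∘ σ ,
    pullback-domColoring σ iso (rot-surjective (toℕ<n x))
      (removeEdge-domColoring O dc x (nxt x) (edge⇒arc x (nxt x) (nxt-adjacent x)) removable)
    where
      open IsOrientation O
      σ = rot (suc (toℕ x))
      iso = path⇔removeEdge-at n≥2 x

  ¬adjacent-nxt³ : ¬ m ∣ 2 → ¬ m ∣ 4 → ∀ u → ¬ CycleG m u (nxt (nxt (nxt u)))
  ¬adjacent-nxt³ m∤2 m∤4 u adjacent with cycle⇒nxt adjacent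
  ... | inj₁ nxt³≡nxt = m∤2 (rot-fixed⇒∣ (trans (rot-suc 1 u) (nxt-injective nxt³≡nxt)))
  ... | inj₂ u≡nxt⁴ = m∤4 (rot-fixed⇒∣ (trans rot4≡nxt⁴ (sym u≡nxt⁴)))
    where
      rot4≡nxt⁴ : rot 4 u ≡ nxt (nxt (nxt (nxt u)))
      rot4≡nxt⁴ = trans (rot-suc 3 u) (cong nxt (trans (rot-suc 2 u) (cong nxt (rot-suc 1 u))))

  cycle-domColoring⇒path-domColoring : 2 ≤ n → ¬ m ∣ 4 → ∀ {D k c} →
    IsOrientation (CycleG m) D → IsDominatorColoring (CycleG m) D k c →
    ¬ ¬ (Σ _ λ D' → IsOrientation (PathG m) D' × HasDomColoring (PathG m) D' k)
  cycle-domColoring⇒path-domColoring n≥2 m∤4 O dc noPath =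
    CycleOrientation.some-edge-removable nxt nxt-injective cycle⇒nxt nxt-adjacent
      (¬adjacent-nxt³ (>⇒∤ (s≤s n≥2)) m∤4) O dc zero
      (λ x removable → noPath (removableEdge⇒path-domColoring n≥2 O dc x removable))

≢4⇒∤4 : ∀ {m} → 3 ≤ m → m ≢ 4 → ¬ m ∣ 4
≢4⇒∤4 {1} (s≤s ())
≢4⇒∤4 {2} (s≤s (s≤s ()))
≢4⇒∤4 {3} _ _ (divides (suc (suc _)) ())
≢4⇒∤4 {4} _ m≢4 = ⊥-elim (m≢4 refl)
≢4⇒∤4 {suc (suc (suc (suc (suc _))))} _ _ = >⇒∤ (s≤s (s≤s (s≤s (s≤s (s≤s z≤n)))))

lemma3 : (m : ℕ) → 3 ≤ m → m ≢ 4 →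
           (a b : ℕ) → IsChiDMin (PathG m) a → IsChiDMin (CycleG m) b → a ≤ b
lemma3 (suc n) m≥3 m≢4 a b (_ , path-minimal) ((_ , O , _ , dc) , _) with a ≤? b
... | yes a≤b = a≤b
... | no a≰b = ⊥-elim
  (Rotation.cycle-domColoring⇒path-domColoring n (s≤s⁻¹ m≥3) (≢4⇒∤4 m≥3 m≢4) O dc
    λ (D' , O' , col) → a≰b (path-minimal D' b O' col))
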